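{- Let $p$ and $q$ be positive integers. A hypergraph $\mathcal H$ is $(p,q)$-Helly if and only if, for every nontrivial $(p+1,q)$-basis $\mathcal S$ of $\mathcal H$, the hypergraph $\mathcal H_{\mathcal S}^\cup$ has core of cardinality at least $q$.
   Context: A hypergraph $\mathcal H$ is a pair $(X,\mathcal E)$ with $X=V(\mathcal H)$ a finite set and $\mathcal E$ a finite family of nonempty subsets of $X$ (edges) whose union is $X$. The core of a family of sets (or of a hypergraph, via its edge family) is the intersection of its members. A family is $(p,q)$-intersecting if every nonempty subfamily of at most $p$ members has core of cardinality at least $q$; a hypergraph is $(p,q)$-Helly if every nonempty $(p,q)$-intersecting subfamily of its edge family has core of cardinality at least $q$. A $(p+1,q)$-basis of $\mathcal H$ is a family $\mathcal S$ of $p+1$ pairwise different $q$-subsets of $V(\mathcal H)$; its support sets are the unions of all but exactly one member of $\mathcal S$; $\mathcal H_{\mathcal S}^\cup$ is the hypergraph formed by the edges of $\mathcal H$ containing some support set of $\mathcal S$; $\mathcal S$ is nontrivial if every support set of $\mathcal S$ is contained in some edge of $\mathcal H$. -}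

module Defs where

open import Data.Nat using (ℕ; suc; _≤_)
open import Data.Fin using (Fin; _≟_)
open import Data.Fin.Subset using (Subset; _∈_; _⊆_; ⋂; ⋃; ∣_∣; Nonempty)
open import Data.Fin.Subset.Properties using (_∈?_)
open import Data.List using (List; map; filter)
open import Data.List.Base using ()
open import Data.Fin.Base using ()
open import Data.List using (allFin)
open import Data.Product using (Σ; ∃; _×_)
open import Relation.Nullary using (¬_; ¬?)
open import Relation.Binary.PropositionalEquality using (_≡_)
open import Function.Definitions using (Injective)

-- A hypergraph on vertex set Fin n with an edge family of m edges
-- (indexed, so repeated edges are allowed: a family, not a set).
record Hypergraph : Set where
  field
    n m      : ℕ
    edge     : Fin m → Subset n
    nonempty : ∀ e → Nonempty (edge e)
    covers   : ∀ (x : Fin n) → ∃ λ e → x ∈ edge e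
open Hypergraph public

members : ∀ {m} → Subset m → List (Fin m)
members {m} J = filter (_∈? J) (allFin m)

core : ∀ {n m} → (Fin m → Subset n) → Subset m → Subset n
core E J = ⋂ (map E (members J))

Intersecting : ℕ → ℕ → ∀ {n m} → (Fin m → Subset n) → Subset m → Set
Intersecting p q E I =
  ∀ J → J ⊆ I → Nonempty J → ∣ J ∣ ≤ p → q ≤ ∣ core E J ∣

Helly : ℕ → ℕ → Hypergraph → Set
Helly p q H = ∀ I → Nonempty I → Intersecting p q (edge H) I → q ≤ ∣ core (edge H) I ∣

record Basis (p q : ℕ) (H : Hypergraph) : Set where
  field
    set      : Fin (suc p) → Subset (n H)
    distinct : Injective _≡_ _≡_ set
    size     : ∀ i → ∣ set i ∣ ≡ q
open Basis public

support : ∀ {p q H} → Basis p q H → Fin (suc p) → Subset (n H)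
support {p} S j = ⋃ (map (set S) (filter (λ i → ¬? (i ≟ j)) (allFin (suc p))))

Nontrivial : ∀ {p q H} → Basis p q H → Set
Nontrivial {H = H} S = ∀ j → ∃ λ e → support S j ⊆ edge H e

-- index set of the edges of H containing some support set of S (H_S^∪)
unionEdges : ∀ {p q H} → Basis p q H → Subset (m H) → Set
unionEdges {H = H} S J = ∀ e → (e ∈ J → ∃ λ j → support S j ⊆ edge H e)
                               × ((∃ λ j → support S j ⊆ edge H e) → e ∈ J)

{-# OPTIONS --safe #-}
module Submission where

-- If H is (p,q)-Helly and S is a nontrivial basis, the edges of H_S^∪ form a
-- nonempty (p,q)-intersecting family: at most p of its edges contain at most p
-- of the p+1 support sets, so some index i is missed, and S_i lies in every
-- other support set, hence in all those edges.  Conversely, a minimal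
-- counterexample I to the Helly property has more than p edges, core I smaller
-- than q, and core (I - e) of size at least q for each e in I.  Choosing p+1
-- edges f_i of I and q-sets T_i inside core (I - f_i) gives a nontrivial basis:
-- equal T_i would lie in core I, the support set of index j lies in the edge
-- f_j, and every edge of I contains a support set.  So H_T^∪ contains I and its
-- core is too small.

open import Defs
open import Data.Empty using (⊥-elim) renaming (⊥ to Empty)
open import Data.Fin using (Fin; zero; suc; _≟_)
open import Data.Fin.Properties using (¬∀⟶∃¬; suc-injective; any?)
open import Data.Fin.Subset
  using (Subset; _∈_; _∉_; _⊆_; ⋂; ⋃; ∣_∣; Nonempty; _∪_; _-_; ⊤; ⊥; inside; outside; ⁅_⁆)
open import Data.Fin.Subset.Properties
  using ( _∈?_; _⊆?_; nonempty?; x∈p∩q⁺; x∈p∩q⁻; x∈p∪q⁺; x∈p∪q⁻; ∈⊤; ∉⊥; ⊥⊆; ∣⊥∣≡0; ∣⊤∣≡n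
        ; out⊆; in⊆in; x∈⁅x⁆; ∣⁅x⁆∣≡1; p⊆q⇒∣p∣≤∣q∣; p─q⊆p; x∈p∧x≢y⇒x∈p-y; x∈p⇒∣p-x∣<∣p∣ )
open import Data.List using (List; []; _∷_; map; filter; allFin)
import Data.List.Membership.Propositional as List
open import Data.List.Membership.Propositional.Properties using (∈-filter⁺; ∈-filter⁻; ∈-allFin)
open import Data.List.Relation.Unary.Any using (here; there)
open import Data.Nat using (ℕ; zero; suc; _≤_; _<_; z≤n; s≤s; _+_; NonZero; _≤?_; >-nonZero⁻¹)
open import Data.Nat.Properties
  using (≤-refl; ≤-reflexive; ≤-trans; ≤-<-trans; <-≤-trans; ≤-pred; <⇒≱; ≤⇒≯; ≰⇒>; n≤1+n; +-suc; +-monoʳ-≤)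
open import Data.Product using (∃; _×_; _,_; proj₁; proj₂)
open import Data.Sum using (inj₁; inj₂)
open import Data.Vec using ([]; _∷_; tabulate; here; there)
open import Data.Vec.Properties using (lookup∘tabulate; lookup⇒[]=; []=⇒lookup)
open import Function using (_∘_; id)
open import Function.Definitions using (Injective)
open import Relation.Binary.PropositionalEquality using (_≡_; _≢_; refl; sym; trans; cong; subst)
open import Relation.Nullary using (¬_; ¬?; yes; no; does)
open import Relation.Nullary.Decidable using (dec-true)
open import Relation.Unary using (Pred; Decidable)

∈-⋂⁺ : ∀ {n k} (E : Fin k → Subset n) (es : List (Fin k)) {x} →
       (∀ {e} → e List.∈ es → x ∈ E e) → x ∈ ⋂ (map E es)
∈-⋂⁺ E []       x∈E = ∈⊤
∈-⋂⁺ E (e ∷ es) x∈E = x∈p∩q⁺ (x∈E (here refl) , ∈-⋂⁺ E es (x∈E ∘ there))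

∈-⋂⁻ : ∀ {n k} (E : Fin k → Subset n) (es : List (Fin k)) {x} →
       x ∈ ⋂ (map E es) → ∀ {e} → e List.∈ es → x ∈ E e
∈-⋂⁻ E (e ∷ es) x∈⋂ (here refl) = proj₁ (x∈p∩q⁻ (E e) _ x∈⋂)
∈-⋂⁻ E (e ∷ es) x∈⋂ (there e∈es) = ∈-⋂⁻ E es (proj₂ (x∈p∩q⁻ (E e) _ x∈⋂)) e∈es

∈-⋃⁺ : ∀ {n k} (E : Fin k → Subset n) (es : List (Fin k)) {e} →
       e List.∈ es → E e ⊆ ⋃ (map E es)
∈-⋃⁺ E (e ∷ es) (here refl)   x∈E = x∈p∪q⁺ (inj₁ x∈E)
∈-⋃⁺ E (e ∷ es) (there e∈es) x∈E = x∈p∪q⁺ (inj₂ (∈-⋃⁺ E es e∈es x∈E))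

∈-⋃⁻ : ∀ {n k} (E : Fin k → Subset n) (es : List (Fin k)) {x} →
       x ∈ ⋃ (map E es) → ∃ λ e → e List.∈ es × x ∈ E e
∈-⋃⁻ E []       x∈⋃ = ⊥-elim (∉⊥ x∈⋃)
∈-⋃⁻ E (e ∷ es) x∈⋃ with x∈p∪q⁻ (E e) _ x∈⋃
... | inj₁ x∈E = e , here refl , x∈E
... | inj₂ x∈⋃es with ∈-⋃⁻ E es x∈⋃es
...   | d , d∈es , x∈E = d , there d∈es , x∈E

∈-members⁺ : ∀ {m} {J : Subset m} {e} → e ∈ J → e List.∈ members J
∈-members⁺ {J = J} {e} = ∈-filter⁺ (_∈? J) (∈-allFin e)

∈-members⁻ : ∀ {m} {J : Subset m} {e} → e List.∈ members J → e ∈ J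
∈-members⁻ {m} {J} = proj₂ ∘ ∈-filter⁻ (_∈? J) {xs = allFin m}

∈-core⁺ : ∀ {n m} (E : Fin m → Subset n) (J : Subset m) {x} →
          (∀ {e} → e ∈ J → x ∈ E e) → x ∈ core E J
∈-core⁺ E J x∈E = ∈-⋂⁺ E (members J) (x∈E ∘ ∈-members⁻)

∈-core⁻ : ∀ {n m} (E : Fin m → Subset n) (J : Subset m) {x} →
          x ∈ core E J → ∀ {e} → e ∈ J → x ∈ E e
∈-core⁻ E J x∈core = ∈-⋂⁻ E (members J) x∈core ∘ ∈-members⁺

core-antitone : ∀ {n m} (E : Fin m → Subset n) {I J : Subset m} → I ⊆ J → core E J ⊆ core E I
core-antitone E {I} {J} I⊆J x∈core = ∈-core⁺ E I (∈-core⁻ E J x∈core ∘ I⊆J)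

∣p∪q∣≤∣p∣+∣q∣ : ∀ {n} (p q : Subset n) → ∣ p ∪ q ∣ ≤ ∣ p ∣ + ∣ q ∣
∣p∪q∣≤∣p∣+∣q∣ []            []            = z≤n
∣p∪q∣≤∣p∣+∣q∣ (outside ∷ p) (outside ∷ q) = ∣p∪q∣≤∣p∣+∣q∣ p q
∣p∪q∣≤∣p∣+∣q∣ (inside ∷ p)  (outside ∷ q) = s≤s (∣p∪q∣≤∣p∣+∣q∣ p q)
∣p∪q∣≤∣p∣+∣q∣ (outside ∷ p) (inside ∷ q)  =
  ≤-trans (s≤s (∣p∪q∣≤∣p∣+∣q∣ p q)) (≤-reflexive (sym (+-suc ∣ p ∣ ∣ q ∣)))
∣p∪q∣≤∣p∣+∣q∣ (inside ∷ p)  (inside ∷ q)  =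
  s≤s (≤-trans (∣p∪q∣≤∣p∣+∣q∣ p q) (+-monoʳ-≤ ∣ p ∣ (n≤1+n ∣ q ∣)))

subset-of-size : ∀ {n} (A : Subset n) k → k ≤ ∣ A ∣ → ∃ λ T → T ⊆ A × ∣ T ∣ ≡ k
subset-of-size {n} A             zero    _        = ⊥ , ⊥⊆ , ∣⊥∣≡0 n
subset-of-size (outside ∷ A)     (suc k) k<∣A∣    with subset-of-size A (suc k) k<∣A∣
... | T , T⊆A , ∣T∣≡k = outside ∷ T , out⊆ T⊆A , ∣T∣≡k
subset-of-size (inside ∷ A)      (suc k) (s≤s k≤∣A∣) with subset-of-size A k k≤∣A∣
... | T , T⊆A , ∣T∣≡k = inside ∷ T , in⊆in T⊆A , cong suc ∣T∣≡k

injection-into : ∀ {m} (I : Subset m) k → k ≤ ∣ I ∣ →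
                 ∃ λ (f : Fin k → Fin m) → Injective _≡_ _≡_ f × (∀ i → f i ∈ I)
injection-into I zero _ = (λ ()) , (λ {i} → ⊥-elim (Fin0-empty i)) , (λ ())
  where
  Fin0-empty : Fin zero → Empty
  Fin0-empty ()
injection-into (outside ∷ I) (suc k) k<∣I∣ with injection-into I (suc k) k<∣I∣
... | f , f-injective , f∈I = suc ∘ f , f-injective ∘ suc-injective , there ∘ f∈I
injection-into {suc m} (inside ∷ I) (suc k) (s≤s k≤∣I∣) with injection-into I k k≤∣I∣
... | f , f-injective , f∈I = g , g-injective , g∈I
  where
  g : Fin (suc k) → Fin (suc m)
  g zero    = zero
  g (suc i) = suc (f i)
  g-injective : Injective _≡_ _≡_ g
  g-injective {zero}  {zero}  _ = refl
  g-injective {suc i} {suc j} g≡ = cong suc (f-injective (suc-injective g≡))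
  g∈I : ∀ i → g i ∈ (inside ∷ I)
  g∈I zero    = here
  g∈I (suc i) = there (f∈I i)

∣p∣<n⇒∃x∉p : ∀ {n} (p : Subset n) → ∣ p ∣ < n → ∃ λ x → x ∉ p
∣p∣<n⇒∃x∉p {n} p ∣p∣<n = ¬∀⟶∃¬ n (_∈ p) (_∈? p) all∈p⇒n≤∣p∣
  where
  all∈p⇒n≤∣p∣ : ¬ (∀ x → x ∈ p)
  all∈p⇒n≤∣p∣ all∈p =
    ≤⇒≯ (subst (_≤ ∣ p ∣) (∣⊤∣≡n n) (p⊆q⇒∣p∣≤∣q∣ {p = ⊤} (λ {x} _ → all∈p x))) ∣p∣<n

1<∣p∣⇒nonempty[p-x] : ∀ {n} (p : Subset n) x → 1 < ∣ p ∣ → Nonempty (p - x)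
1<∣p∣⇒nonempty[p-x] p x 1<∣p∣ with nonempty? (p - x)
... | yes p-x≢∅ = p-x≢∅
... | no  p-x≡∅ = ⊥-elim (<⇒≱ 1<∣p∣ (subst (∣ p ∣ ≤_) (∣⁅x⁆∣≡1 x) (p⊆q⇒∣p∣≤∣q∣ p⊆⁅x⁆)))
  where
  p⊆⁅x⁆ : p ⊆ ⁅ x ⁆
  p⊆⁅x⁆ {y} y∈p with y ≟ x
  ... | yes refl = x∈⁅x⁆ y
  ... | no  y≢x  = ⊥-elim (p-x≡∅ (y , x∈p∧x≢y⇒x∈p-y y∈p y≢x))

covering-image : ∀ {m k} (R : Fin m → Fin k → Set) (K : Subset m) → (∀ e → e ∈ K → ∃ (R e)) →
                 ∃ λ U → ∣ U ∣ ≤ ∣ K ∣ × (∀ e → e ∈ K → ∃ λ j → j ∈ U × R e j)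
covering-image {k = k} R [] _ = ⊥ , ≤-reflexive (∣⊥∣≡0 k) , λ _ ()
covering-image R (outside ∷ K) R-total
  with covering-image (R ∘ suc) K (λ e → R-total (suc e) ∘ there)
... | U , ∣U∣≤∣K∣ , covers = U , ∣U∣≤∣K∣ , λ { (suc e) (there e∈K) → covers e e∈K }
covering-image R (inside ∷ K) R-total
  with R-total zero here | covering-image (R ∘ suc) K (λ e → R-total (suc e) ∘ there)
... | j₀ , R0j₀ | U , ∣U∣≤∣K∣ , covers = ⁅ j₀ ⁆ ∪ U , ∣⁅j₀⁆∪U∣≤1+∣K∣ , covers₀
  where
  ∣⁅j₀⁆∪U∣≤1+∣K∣ : ∣ ⁅ j₀ ⁆ ∪ U ∣ ≤ suc ∣ K ∣
  ∣⁅j₀⁆∪U∣≤1+∣K∣ = ≤-trans (∣p∪q∣≤∣p∣+∣q∣ ⁅ j₀ ⁆ U)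
                           (subst (λ c → c + ∣ U ∣ ≤ suc ∣ K ∣) (sym (∣⁅x⁆∣≡1 j₀)) (s≤s ∣U∣≤∣K∣))
  covers₀ : ∀ e → e ∈ (inside ∷ K) → ∃ λ j → j ∈ ⁅ j₀ ⁆ ∪ U × R e j
  covers₀ zero    here         = j₀ , x∈p∪q⁺ (inj₁ (x∈⁅x⁆ j₀)) , R0j₀
  covers₀ (suc e) (there e∈K) with covers e e∈K
  ... | j , j∈U , Rej = j , x∈p∪q⁺ (inj₂ j∈U) , Rej

unused-index : ∀ {m p} (R : Fin m → Fin (suc p) → Set) (K : Subset m) → ∣ K ∣ ≤ p →
               (∀ e → e ∈ K → ∃ (R e)) → ∃ λ i → ∀ e → e ∈ K → ∃ λ j → j ≢ i × R e j
unused-index R K ∣K∣≤p R-total with covering-image R K R-total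
... | U , ∣U∣≤∣K∣ , covers with ∣p∣<n⇒∃x∉p U (s≤s (≤-trans ∣U∣≤∣K∣ ∣K∣≤p))
...   | i , i∉U = i , avoids
  where
  avoids : ∀ e → e ∈ K → ∃ λ j → j ≢ i × R e j
  avoids e e∈K with covers e e∈K
  ... | j , j∈U , Rej = j , (λ { refl → i∉U j∈U }) , Rej

characteristic-subset : ∀ {m ℓ} {P : Pred (Fin m) ℓ} → Decidable P →
                        ∃ λ J → ∀ e → (e ∈ J → P e) × (P e → e ∈ J)
characteristic-subset {m} {P = P} P? = J , λ e → ∈J⇒P e , P⇒∈J e
  where
  J : Subset m
  J = tabulate (does ∘ P?)
  ∈J⇒P : ∀ e → e ∈ J → P e
  ∈J⇒P e e∈J with P? e | lookup∘tabulate (does ∘ P?) e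
  ... | yes Pe | _      = Pe
  ... | no  _  | J[e]≡ with () ← trans (sym ([]=⇒lookup e∈J)) J[e]≡
  P⇒∈J : ∀ e → P e → e ∈ J
  P⇒∈J e Pe = lookup⇒[]= e J (trans (lookup∘tabulate (does ∘ P?) e) (dec-true (P? e) Pe))

Intersecting-antitone : ∀ {p q n m} (E : Fin m → Subset n) {I J : Subset m} →
                        J ⊆ I → Intersecting p q E I → Intersecting p q E J
Intersecting-antitone E J⊆I I-intersecting K K⊆J =
  I-intersecting K (J⊆I ∘ K⊆J)

⊆-support : ∀ {p q H} (S : Basis p q H) {i j} → i ≢ j → set S i ⊆ support S j
⊆-support {p} S {i} {j} i≢j =
  ∈-⋃⁺ (set S) (filter (λ k → ¬? (k ≟ j)) (allFin (suc p)))
       (∈-filter⁺ (λ k → ¬? (k ≟ j)) (∈-allFin i) i≢j)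

∈-support⁻ : ∀ {p q H} (S : Basis p q H) {j x} → x ∈ support S j → ∃ λ i → i ≢ j × x ∈ set S i
∈-support⁻ {p} S {j} x∈support
  with ∈-⋃⁻ (set S) (filter (λ k → ¬? (k ≟ j)) (allFin (suc p))) x∈support
... | i , i∈others , x∈Sᵢ =
  i , proj₂ (∈-filter⁻ (λ k → ¬? (k ≟ j)) {xs = allFin (suc p)} i∈others) , x∈Sᵢ

UnionCoresLarge : ℕ → ℕ → Hypergraph → Set
UnionCoresLarge p q H =
  (S : Basis p q H) → Nontrivial S → (J : Subset (m H)) → unionEdges S J → q ≤ ∣ core (edge H) J ∣

Helly⇒UnionCoresLarge : ∀ {p q} (H : Hypergraph) → Helly p q H → UnionCoresLarge p q H
Helly⇒UnionCoresLarge {p} {q} H helly S nontrivial J J-union = helly J J-nonempty J-intersecting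
  where
  J-nonempty : Nonempty J
  J-nonempty with nontrivial zero
  ... | e , support⊆e = e , proj₂ (J-union e) (zero , support⊆e)
  J-intersecting : Intersecting p q (edge H) J
  J-intersecting K K⊆J _ ∣K∣≤p
    with unused-index (λ e j → support S j ⊆ edge H e) K ∣K∣≤p (λ e → proj₁ (J-union e) ∘ K⊆J)
  ... | i , missed = subst (_≤ ∣ core (edge H) K ∣) (size S i) (p⊆q⇒∣p∣≤∣q∣ Sᵢ⊆core)
    where
    Sᵢ⊆core : set S i ⊆ core (edge H) K
    Sᵢ⊆core {x} x∈Sᵢ = ∈-core⁺ (edge H) K x∈edge
      where
      x∈edge : ∀ {e} → e ∈ K → x ∈ edge H e
      x∈edge {e} e∈K with missed e e∈K
      ... | j , j≢i , support⊆e = support⊆e (⊆-support S (j≢i ∘ sym) x∈Sᵢ)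

module MinimalCounterexample
  {p q : ℕ} (H : Hypergraph) (I : Subset (m H)) (p<∣I∣ : p < ∣ I ∣)
  (core[I-e]-large : ∀ e → e ∈ I → q ≤ ∣ core (edge H) (I - e) ∣)
  (core[I]-small : ¬ q ≤ ∣ core (edge H) I ∣)
  where

  E : Fin (m H) → Subset (n H)
  E = edge H

  chosen-edges : ∃ λ (f : Fin (suc p) → Fin (m H)) → Injective _≡_ _≡_ f × (∀ i → f i ∈ I)
  chosen-edges = injection-into I (suc p) p<∣I∣

  f : Fin (suc p) → Fin (m H)
  f = proj₁ chosen-edges

  f-injective : Injective _≡_ _≡_ f
  f-injective = proj₁ (proj₂ chosen-edges)

  f∈I : ∀ i → f i ∈ I
  f∈I = proj₂ (proj₂ chosen-edges)

  chosen-sets : ∀ i → ∃ λ T → T ⊆ core E (I - f i) × ∣ T ∣ ≡ q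
  chosen-sets i = subset-of-size (core E (I - f i)) q (core[I-e]-large (f i) (f∈I i))

  T : Fin (suc p) → Subset (n H)
  T = proj₁ ∘ chosen-sets

  ∣T∣≡q : ∀ i → ∣ T i ∣ ≡ q
  ∣T∣≡q = proj₂ ∘ proj₂ ∘ chosen-sets

  T⊆edge : ∀ i {e} → e ∈ I → e ≢ f i → T i ⊆ E e
  T⊆edge i {e} e∈I e≢fᵢ x∈T =
    ∈-core⁻ E (I - f i) (proj₁ (proj₂ (chosen-sets i)) x∈T) (x∈p∧x≢y⇒x∈p-y e∈I e≢fᵢ)

  T-injective : Injective _≡_ _≡_ T
  T-injective {i₁} {i₂} T₁≡T₂ with i₁ ≟ i₂
  ... | yes i₁≡i₂ = i₁≡i₂
  ... | no  i₁≢i₂ = ⊥-elim (core[I]-small (subst (_≤ ∣ core E I ∣) (∣T∣≡q i₁) (p⊆q⇒∣p∣≤∣q∣ T₁⊆core)))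
    where
    T₁⊆core : T i₁ ⊆ core E I
    T₁⊆core {x} x∈T₁ = ∈-core⁺ E I x∈edge
      where
      x∈edge : ∀ {e} → e ∈ I → x ∈ E e
      x∈edge {e} e∈I with e ≟ f i₁
      ... | yes refl = T⊆edge i₂ e∈I (i₁≢i₂ ∘ f-injective) (subst (x ∈_) T₁≡T₂ x∈T₁)
      ... | no  e≢f₁ = T⊆edge i₁ e∈I e≢f₁ x∈T₁

  basis : Basis p q H
  basis = record { set = T ; distinct = T-injective ; size = ∣T∣≡q }

  support⊆edge : ∀ j {e} → e ∈ I → (∀ i → i ≢ j → e ≢ f i) → support basis j ⊆ E e
  support⊆edge j e∈I e-avoids x∈support with ∈-support⁻ basis x∈support
  ... | i , i≢j , x∈Tᵢ = T⊆edge i e∈I (e-avoids i i≢j) x∈Tᵢ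

  index-avoided-by : ∀ e → ∃ λ j → ∀ i → i ≢ j → e ≢ f i
  index-avoided-by e with any? (λ j → e ≟ f j)
  ... | yes (j , e≡fⱼ) = j , λ i i≢j e≡fᵢ → i≢j (f-injective (trans (sym e≡fᵢ) e≡fⱼ))
  ... | no  e∉f        = zero , λ i _ e≡fᵢ → e∉f (i , e≡fᵢ)

  nontrivial : Nontrivial basis
  nontrivial j = f j , support⊆edge j (f∈I j) (λ i i≢j fⱼ≡fᵢ → i≢j (f-injective (sym fⱼ≡fᵢ)))

  union-edges : ∃ (unionEdges basis)
  union-edges = characteristic-subset (λ e → any? (λ j → support basis j ⊆? E e))

  J : Subset (m H)
  J = proj₁ union-edges

  J-union : unionEdges basis J
  J-union = proj₂ union-edges

  I⊆J : I ⊆ J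
  I⊆J {e} e∈I with index-avoided-by e
  ... | j , e-avoids = proj₂ (J-union e) (j , support⊆edge j e∈I e-avoids)

  ¬UnionCoresLarge : ¬ UnionCoresLarge p q H
  ¬UnionCoresLarge large =
    core[I]-small (≤-trans (large basis nontrivial J J-union) (p⊆q⇒∣p∣≤∣q∣ (core-antitone E I⊆J)))

UnionCoresLarge⇒Helly : ∀ {p q} .{{_ : NonZero p}} (H : Hypergraph) → UnionCoresLarge p q H → Helly p q H
UnionCoresLarge⇒Helly {p} {q} H large I I≢∅ I-intersecting = helly-below ∣ I ∣ I ≤-refl I≢∅ I-intersecting
  where
  E : Fin (m H) → Subset (n H)
  E = edge H
  helly-below : ∀ k I → ∣ I ∣ ≤ k → Nonempty I → Intersecting p q E I → q ≤ ∣ core E I ∣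
  helly-below k I ∣I∣≤k I≢∅ I-intersecting with ∣ I ∣ ≤? p | q ≤? ∣ core E I ∣
  ... | yes ∣I∣≤p | _ = I-intersecting I id I≢∅ ∣I∣≤p
  ... | no  _     | yes core-large = core-large
  helly-below zero I ∣I∣≤0 _ _ | no ∣I∣≰p | no _ = ⊥-elim (∣I∣≰p (≤-trans ∣I∣≤0 z≤n))
  helly-below (suc k) I ∣I∣≤1+k _ I-intersecting | no ∣I∣≰p | no core-small =
    ⊥-elim (MinimalCounterexample.¬UnionCoresLarge H I p<∣I∣ core[I-e]-large core-small large)
    where
    p<∣I∣ : p < ∣ I ∣
    p<∣I∣ = ≰⇒> ∣I∣≰p
    core[I-e]-large : ∀ e → e ∈ I → q ≤ ∣ core E (I - e) ∣
    core[I-e]-large e e∈I =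
      helly-below k (I - e) (≤-pred (<-≤-trans (x∈p⇒∣p-x∣<∣p∣ e∈I) ∣I∣≤1+k))
        (1<∣p∣⇒nonempty[p-x] I e (≤-<-trans (>-nonZero⁻¹ p) p<∣I∣))
        (Intersecting-antitone E (p─q⊆p I ⁅ e ⁆) I-intersecting)

corollary2p4 : (p q : ℕ) → NonZero p → NonZero q → (H : Hypergraph) →
    (Helly p q H → (S : Basis p q H) → Nontrivial S → (J : Subset (m H)) → unionEdges S J → q ≤ ∣ core (edge H) J ∣)
    × (((S : Basis p q H) → Nontrivial S → (J : Subset (m H)) → unionEdges S J → q ≤ ∣ core (edge H) J ∣) → Helly p q H)
corollary2p4 p q p≢0 _ H = Helly⇒UnionCoresLarge H , UnionCoresLarge⇒Helly {{p≢0}} H
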